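{- Let $n\ge1$, $w\in S_n$ with $w\ne w_0$, and let $(i,j)$ be an addable cell of $\mathrm{dom}(w)$ with $j=\alpha(w)$. Let $\mathcal P\in\overline{\mathsf{Pipes}}(w)$ and $\mathcal Q=\mathcal P\cup\{(i,j)\}$. Then $\delta(\check{\mathcal Q})\,\square\,\tau_i=\delta(\check{\mathcal P})$.
   Context: $S_n$ symmetric group, $s_i=(i\ i+1)$, $w_0=n\,n-1\cdots1$. For $v\in S_n$, $v\,\square\,\tau_k=vs_k$ if $\ell(vs_k)<\ell(v)$ and $v\,\square\,\tau_k=v$ otherwise. Demazure product: $\delta(\emptyset)=\mathrm{id}$, $\delta(a_1,\dots,a_k)=\delta(a_1,\dots,a_{k-1})*\tau_{a_k}$, $v*\tau_m=vs_m$ if $\ell(vs_m)>\ell(v)$, else $v$. $\mathbb T_n=\{(i,j)\in[n]^2:i+j\le n\}$; a pipe dream is $\mathcal P\subseteq\mathbb T_n$ with word $\mathbf a_{\mathcal P}$ (cells column by column right to left, top to bottom within columns, letter $i+j-1$), $\delta(\mathcal P)=\delta(\mathbf a_{\mathcal P})$, $\overline{\mathsf{Pipes}}(w)=\{\mathcal P\subseteq\mathbb T_n:\delta(\mathcal P)=w\}$. Co-pipe dream $\check{\mathcal P}=\{(i+j,j):(i,j)\in\mathbb T_n\setminus\mathcal P\}$ with word $\mathbf a_{\check{\mathcal P}}$ (cells column by column right to left, bottom to top within columns, letter $n-i+j$) and $\delta(\check{\mathcal P})=\delta(\mathbf a_{\check{\mathcal P}})w_0$. Rothe diagram $D(w)=\{(i,j):j<w(i),\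 i<w^{ -1}(j)\}$; $\mathrm{dom}(w)$ the largest Young diagram (top-left justified partition shape) in $D(w)$; an addable cell of a Young diagram $Y$ is $(i,j)\notin Y$ with $(i-1,j)\in Y$ if $i>1$ and $(i,j-1)\in Y$ if $j>1$. For $w\ne w_0$, $\alpha(w)$ is the least $j$ such that $\mathrm{dom}(w)$ has an addable cell $(i,j)$ with $i+j\le n$. -}

module Defs where

open import Data.Nat using (ℕ; zero; suc; _+_; _∸_; _≤_; _<_; _<?_; _≡ᵇ_)
open import Data.Bool using (Bool; true; false; if_then_else_; not; _∧_)
open import Data.List using (List; []; _∷_; length; filter; map; upTo; downFrom; foldl; concatMap; reverse)
open import Data.Bool.ListAction using (any)
open import Data.List.Relation.Binary.Permutation.Propositional using (_↭_)
open import Data.Product using (_×_; _,_; Σ; ∃)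
open import Relation.Nullary using (¬_)
open import Relation.Binary.PropositionalEquality using (_≡_)
open import Data.List.Relation.Unary.All using (All)
open import Data.Maybe using (Maybe; just; nothing)
open import Relation.Nullary.Decidable using (⌊_⌋)

-- Permutations of S_n in one-line notation: the list [w(1), …, w(n)].
idPerm : ℕ → List ℕ
idPerm n = map suc (upTo n)

IsPerm : ℕ → List ℕ → Set
IsPerm n w = w ↭ idPerm n

w0 : ℕ → List ℕ
w0 n = reverse (idPerm n)

-- v ↦ v w₀ (right multiplication by w₀ reverses the one-line notation)
mulW0 : List ℕ → List ℕ
mulW0 = reverse

-- v ↦ v s_k  (swap positions k and k+1, 1-based)
swapAt : ℕ → List ℕ → List ℕ
swapAt (suc zero) (a ∷ b ∷ xs) = b ∷ a ∷ xs
swapAt (suc (suc k)) (x ∷ xs) = x ∷ swapAt (suc k) xs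
swapAt _ xs = xs

len : List ℕ → ℕ
len [] = 0
len (x ∷ xs) = length (filter (λ y → y <? x) xs) + len xs

demStep : List ℕ → ℕ → List ℕ
demStep v m = if ⌊ len v <? len (swapAt m v) ⌋ then swapAt m v else v

box : List ℕ → ℕ → List ℕ
box v k = if ⌊ len (swapAt k v) <? len v ⌋ then swapAt k v else v

δ : ℕ → List ℕ → List ℕ
δ n = foldl demStep (idPerm n)

-- Cells: pairs (row, column), 1-based.
Cell : Set
Cell = ℕ × ℕ

memb : Cell → List Cell → Bool
memb (i , j) = any (λ c → (Data.Product.proj₁ c ≡ᵇ i) ∧ (Data.Product.proj₂ c ≡ᵇ j))

InT : ℕ → Cell → Set
InT n (i , j) = (1 ≤ i) × (1 ≤ j) × (i + j ≤ n)

colsRL : ℕ → List ℕ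
colsRL n = map suc (downFrom (n ∸ 1))

rowsTB : ℕ → ℕ → List ℕ
rowsTB n j = map suc (upTo (n ∸ j))

cellsT : ℕ → List Cell
cellsT n = concatMap (λ j → map (λ i → (i , j)) (rowsTB n j)) (colsRL n)

wordP : ℕ → List Cell → List ℕ
wordP n P = concatMap (λ j → concatMap (λ i → if memb (i , j) P then (i + j ∸ 1) ∷ [] else [])
                                        (rowsTB n j))
                      (colsRL n)

δP : ℕ → List Cell → List ℕ
δP n P = δ n (wordP n P)

-- Pipes‾(w) : P ⊆ 𝕋_n with δ(P) = w   (P given as a list of cells, read as a set)
InPipes : ℕ → List ℕ → List Cell → Set
InPipes n w P = All (InT n) P × (δP n P ≡ w)

coP : ℕ → List Cell → List Cell
coP n P = map (λ c → (Data.Product.proj₁ c + Data.Product.proj₂ c , Data.Product.proj₂ c))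
              (filter (λ c → Data.Bool.T? (not (memb c P))) (cellsT n))
  where import Data.Bool

rowsBT : ℕ → ℕ → List ℕ
rowsBT n j = map (λ t → n ∸ t) (upTo (n ∸ j))

wordCo : ℕ → List Cell → List ℕ
wordCo n C = concatMap (λ j → concatMap (λ a → if memb (a , j) C then (n ∸ a + j) ∷ [] else [])
                                          (rowsBT n j))
                       (colsRL n)

δco : ℕ → List Cell → List ℕ
δco n P = mulW0 (δ n (wordCo n (coP n P)))

-- w(i) (1-based; 0 outside [n])
at : List ℕ → ℕ → ℕ
at [] _ = 0
at (x ∷ xs) zero = 0
at (x ∷ xs) (suc zero) = x
at (x ∷ xs) (suc (suc i)) = at xs (suc i)

-- w⁻¹(j) (1-based; 0 if j does not occur)
posOf : List ℕ → ℕ → ℕ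
posOf [] j = 0
posOf (x ∷ xs) j = if x ≡ᵇ j then 1 else (if posOf xs j ≡ᵇ 0 then 0 else suc (posOf xs j))

InRothe : List ℕ → ℕ → ℕ → Set
InRothe w i j = (j < at w i) × (i < posOf w j)

-- dom(w): the largest Young diagram contained in D(w), i.e. the union of all
-- top-left justified diagrams in D(w): (i,j) ∈ dom(w) iff i,j ≥ 1 and the
-- whole rectangle [1,i]×[1,j] lies in D(w).
InDom : List ℕ → ℕ → ℕ → Set
InDom w i j = (1 ≤ i) × (1 ≤ j) ×
              (∀ i' j' → 1 ≤ i' → i' ≤ i → 1 ≤ j' → j' ≤ j → InRothe w i' j')

Addable : List ℕ → ℕ → ℕ → Set
Addable w i j = (1 ≤ i) × (1 ≤ j) × ¬ InDom w i j ×
                (1 < i → InDom w (i ∸ 1) j) × (1 < j → InDom w i (j ∸ 1))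

HasAddableIn : ℕ → List ℕ → ℕ → Set
HasAddableIn n w j = ∃ λ i → Addable w i j × (i + j ≤ n)

IsAlpha : ℕ → List ℕ → ℕ → Set
IsAlpha n w j = HasAddableIn n w j × (∀ j' → j' < j → ¬ HasAddableIn n w j')

-- Cells of dom(w) lie in P: a staircase cell (a, b) ∉ P forces a value ≤ b among the
-- first a entries of δ(P), which is counted column by column.  Hence P contains every staircase cell
-- left of column j = α(w) (they all lie in dom(w) by minimality of α) and the cells above (i, j).
-- It does not contain (i, j): otherwise the value j could never reach the first i positions, and (i, j)
-- would lie in dom(w).  So the co-pipe dream of Q is that of P without (i + j, j), and every cell read
-- after (i + j, j) is missing from both.  The co-word of P therefore ends with the letter n − i, and
-- reversal (right multiplication by w₀) turns this last Demazure step into □ τᵢ.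

module Submission where

open import Defs
open import Algebra.Properties.CommutativeSemigroup as CSemigroup using ()
open import Data.Nat
open import Data.Nat.Properties
open import Data.Bool using (Bool; true; false; if_then_else_; not; _∧_; _∨_; T?)
open import Data.Bool.ListAction using (any)
open import Data.Bool.Properties using (T-≡; ∧-zeroʳ; ∨-zeroʳ)
import Data.Bool as Bool
open import Data.List
  using (List; []; _∷_; _++_; _∷ʳ_; length; filter; reverse; foldl; map; upTo; downFrom; applyUpTo; concatMap)
open import Data.List.Properties
  using (length-++; length-map; length-upTo; length-reverse; ++-assoc; ++-identityʳ; reverse-++
        ; unfold-reverse; foldl-++; concatMap-++; concatMap-cong; map-upTo; filter-accept; filter-reject)
open import Data.List.Relation.Unary.All using (All; []; _∷_)
import Data.List.Relation.Unary.All as All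
open import Data.List.Relation.Unary.Any using (here; there)
open import Data.List.Membership.Propositional using (_∈_; lose)
open import Data.List.Membership.Propositional.Properties using (∈-concatMap⁺; ∈-map⁺; ∈-map⁻; ∈-upTo⁺; ∈-downFrom⁺)
open import Data.List.Relation.Unary.AllPairs using (AllPairs; []; _∷_)
import Data.List.Relation.Unary.AllPairs as AllPairs
open import Data.List.Relation.Unary.Unique.Propositional using (Unique)
import Data.List.Relation.Unary.Unique.Propositional.Properties as Unique
import Data.List.Relation.Binary.Permutation.Setoid.Properties as PermProperties
open import Data.List.Relation.Binary.Permutation.Propositional
  using (_↭_; ↭-refl; ↭-prep; ↭-swap; ↭-trans; ↭-sym; ↭⇒↭ₛ)
open import Data.List.Relation.Binary.Permutation.Propositional.Properties using (↭-length; filter-↭; ∈-resp-↭)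
open import Data.Empty using (⊥-elim)
open import Data.Product using (Σ; _×_; _,_; proj₁; proj₂)
open import Data.Sum using (inj₁; inj₂)
open import Relation.Binary using (tri<; tri≈; tri>)
open import Relation.Nullary using (¬_; Dec; yes; no)
open import Relation.Nullary.Negation using (¬¬-map)
open import Relation.Nullary.Decidable using (⌊_⌋; does; dec-true; dec-false; decidable-stable)
open import Relation.Binary.PropositionalEquality
open import Function using (_∘′_; _⇔_; mk⇔; Equivalence; case_of_)
import Function.Properties.Equivalence as ⇔

open CSemigroup +-commutativeSemigroup using (x∙yz≈y∙xz)

-- Adjacent transpositions, the Demazure step and □ τ

swapAt-↭ : ∀ m v → swapAt m v ↭ v
swapAt-↭ zero          v           = ↭-refl
swapAt-↭ (suc zero)    []          = ↭-refl
swapAt-↭ (suc zero)    (a ∷ [])    = ↭-refl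
swapAt-↭ (suc zero)    (a ∷ b ∷ v) = ↭-swap b a ↭-refl
swapAt-↭ (suc (suc m)) []          = ↭-refl
swapAt-↭ (suc (suc m)) (x ∷ v)     = ↭-prep x (swapAt-↭ (suc m) v)

at-swapAt-other : ∀ m v k → k ≢ m → k ≢ suc m → at (swapAt m v) k ≡ at v k
at-swapAt-other zero          v           k                   _   _    = refl
at-swapAt-other (suc zero)    []          k                   _   _    = refl
at-swapAt-other (suc zero)    (a ∷ [])    k                   _   _    = refl
at-swapAt-other (suc zero)    (a ∷ b ∷ v) zero                _   _    = refl
at-swapAt-other (suc zero)    (a ∷ b ∷ v) (suc zero)          k≢1 _    = ⊥-elim (k≢1 refl)
at-swapAt-other (suc zero)    (a ∷ b ∷ v) (suc (suc zero))    _   k≢2  = ⊥-elim (k≢2 refl)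
at-swapAt-other (suc zero)    (a ∷ b ∷ v) (suc (suc (suc k))) _   _    = refl
at-swapAt-other (suc (suc m)) []          k                   _   _    = refl
at-swapAt-other (suc (suc m)) (x ∷ v)     zero                _   _    = refl
at-swapAt-other (suc (suc m)) (x ∷ v)     (suc zero)          _   _    = refl
at-swapAt-other (suc (suc m)) (x ∷ v)     (suc (suc k))       k≢m k≢m+1 =
  at-swapAt-other (suc m) v (suc k) (k≢m ∘′ cong suc) (k≢m+1 ∘′ cong suc)

data AdjacentPair : List ℕ → ℕ → Set where
  adjacentPair : ∀ as a b bs → AdjacentPair (as ++ a ∷ b ∷ bs) (suc (length as))

adjacentPairAt : ∀ m v → 1 ≤ m → m < length v → AdjacentPair v m
adjacentPairAt (suc zero)    (a ∷ b ∷ bs) _ _ = adjacentPair [] a b bs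
adjacentPairAt (suc zero)    (a ∷ [])     _ (s≤s ())
adjacentPairAt (suc (suc m)) (x ∷ v)      _ (s≤s m<v)
  with adjacentPairAt (suc m) v (s≤s z≤n) m<v
... | adjacentPair as a b bs = adjacentPair (x ∷ as) a b bs

swapAt-adjacent : ∀ (as : List ℕ) a b bs → swapAt (suc (length as)) (as ++ a ∷ b ∷ bs) ≡ as ++ b ∷ a ∷ bs
swapAt-adjacent []           a b bs = refl
swapAt-adjacent (x ∷ [])     a b bs = refl
swapAt-adjacent (x ∷ y ∷ as) a b bs = cong (x ∷_) (swapAt-adjacent (y ∷ as) a b bs)

at-adjacent₁ : ∀ (as : List ℕ) a b bs → at (as ++ a ∷ b ∷ bs) (suc (length as)) ≡ a
at-adjacent₁ []       a b bs = refl
at-adjacent₁ (x ∷ as) a b bs = at-adjacent₁ as a b bs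

at-adjacent₂ : ∀ (as : List ℕ) a b bs → at (as ++ a ∷ b ∷ bs) (suc (suc (length as))) ≡ b
at-adjacent₂ []       a b bs = refl
at-adjacent₂ (x ∷ as) a b bs = at-adjacent₂ as a b bs

Unique-adjacent : ∀ (as : List ℕ) a b bs → Unique (as ++ a ∷ b ∷ bs) → a ≢ b
Unique-adjacent []       a b bs ((a≢b ∷ _) ∷ _) = a≢b
Unique-adjacent (x ∷ as) a b bs (_ ∷ u)          = Unique-adjacent as a b bs u

reverse-adjacent : ∀ (as : List ℕ) a b bs → reverse (as ++ a ∷ b ∷ bs) ≡ reverse bs ++ b ∷ a ∷ reverse as
reverse-adjacent as a b bs = begin
  reverse (as ++ a ∷ b ∷ bs)                  ≡⟨ reverse-++ as (a ∷ b ∷ bs) ⟩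
  reverse (a ∷ b ∷ bs) ++ reverse as          ≡⟨ cong (_++ reverse as) (trans (unfold-reverse a (b ∷ bs))
                                                     (cong (_∷ʳ a) (unfold-reverse b bs))) ⟩
  ((reverse bs ∷ʳ b) ∷ʳ a) ++ reverse as      ≡⟨ ++-assoc (reverse bs ∷ʳ b) (a ∷ []) (reverse as) ⟩
  (reverse bs ∷ʳ b) ++ a ∷ reverse as         ≡⟨ ++-assoc (reverse bs) (b ∷ []) (a ∷ reverse as) ⟩
  reverse bs ++ b ∷ a ∷ reverse as            ∎
  where open ≡-Reasoning

len-adjacent-ascent : ∀ (as : List ℕ) a b bs → a < b → len (as ++ b ∷ a ∷ bs) ≡ suc (len (as ++ a ∷ b ∷ bs))
len-adjacent-ascent [] a b bs a<b
  rewrite filter-accept (_<? b) {xs = bs} a<b | filter-reject (_<? a) {xs = bs} (<-asym a<b) =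
  cong suc (x∙yz≈y∙xz (length (filter (_<? b) bs)) (length (filter (_<? a) bs)) (len bs))
len-adjacent-ascent (x ∷ as) a b bs a<b =
  trans (cong₂ _+_ smaller (len-adjacent-ascent as a b bs a<b)) (+-suc _ _)
  where
  smaller : length (filter (_<? x) (as ++ b ∷ a ∷ bs)) ≡ length (filter (_<? x) (as ++ a ∷ b ∷ bs))
  smaller = ↭-length (filter-↭ (_<? x) (subst (_↭ as ++ a ∷ b ∷ bs) (swapAt-adjacent as a b bs)
                                              (swapAt-↭ (suc (length as)) (as ++ a ∷ b ∷ bs))))

if-dec-yes : ∀ {P A : Set} {x y : A} (d : Dec P) → P → (if ⌊ d ⌋ then x else y) ≡ x
if-dec-yes (yes _) _ = refl
if-dec-yes (no ¬p) p = ⊥-elim (¬p p)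

if-dec-no : ∀ {P A : Set} {x y : A} (d : Dec P) → ¬ P → (if ⌊ d ⌋ then x else y) ≡ y
if-dec-no (yes p) ¬p = ⊥-elim (¬p p)
if-dec-no (no _)  _  = refl

module _ (as : List ℕ) (a b : ℕ) (bs : List ℕ) where
  private
    v v′ : List ℕ
    v  = as ++ a ∷ b ∷ bs
    v′ = as ++ b ∷ a ∷ bs
    m : ℕ
    m = suc (length as)
    swap≡ : swapAt m v ≡ v′
    swap≡ = swapAt-adjacent as a b bs
    gain : a < b → len v < len v′
    gain a<b = ≤-reflexive (sym (len-adjacent-ascent as a b bs a<b))
    loss : b < a → len v′ < len v
    loss b<a = ≤-reflexive (sym (len-adjacent-ascent as b a bs b<a))
    tie : a ≡ b → v′ ≡ v
    tie refl = refl

  demStep-ascent : a < b → demStep v m ≡ v′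
  demStep-ascent a<b =
    trans (if-dec-yes (len v <? len (swapAt m v)) (subst (len v <_) (sym (cong len swap≡)) (gain a<b))) swap≡

  demStep-nonascent : ¬ a < b → demStep v m ≡ v
  demStep-nonascent a≮b = if-dec-no (len v <? len (swapAt m v)) (no-gain ∘′ subst (len v <_) (cong len swap≡))
    where
    no-gain : ¬ len v < len v′
    no-gain with <-cmp a b
    ... | tri< a<b _ _ = ⊥-elim (a≮b a<b)
    ... | tri≈ _ a≡b _ = <-irrefl (sym (cong len (tie a≡b)))
    ... | tri> _ _ b<a = <-asym (loss b<a)

  box-descent : b < a → box v m ≡ v′
  box-descent b<a =
    trans (if-dec-yes (len (swapAt m v) <? len v) (subst (_< len v) (sym (cong len swap≡)) (loss b<a))) swap≡

  box-nondescent : ¬ b < a → box v m ≡ v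
  box-nondescent b≮a = if-dec-no (len (swapAt m v) <? len v) (no-loss ∘′ subst (_< len v) (cong len swap≡))
    where
    no-loss : ¬ len v′ < len v
    no-loss with <-cmp a b
    ... | tri< a<b _ _ = <-asym (gain a<b)
    ... | tri≈ _ a≡b _ = <-irrefl (cong len (tie a≡b))
    ... | tri> _ _ b<a = ⊥-elim (b≮a b<a)

box-reverse : ∀ (as : List ℕ) a b bs →
  box (reverse (as ++ a ∷ b ∷ bs)) (suc (length bs)) ≡ reverse (demStep (as ++ a ∷ b ∷ bs) (suc (length as)))
box-reverse as a b bs = begin
  box (reverse (as ++ a ∷ b ∷ bs)) (suc (length bs))
    ≡⟨ cong₂ box (reverse-adjacent as a b bs) (cong suc (sym (length-reverse bs))) ⟩
  box (reverse bs ++ b ∷ a ∷ reverse as) (suc (length (reverse bs)))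
    ≡⟨ mirrored ⟩
  reverse (demStep (as ++ a ∷ b ∷ bs) (suc (length as))) ∎
  where
  open ≡-Reasoning
  mirrored : box (reverse bs ++ b ∷ a ∷ reverse as) (suc (length (reverse bs)))
           ≡ reverse (demStep (as ++ a ∷ b ∷ bs) (suc (length as)))
  mirrored with a <? b
  ... | yes a<b = trans (box-descent (reverse bs) b a (reverse as) a<b)
                        (trans (sym (reverse-adjacent as b a bs)) (cong reverse (sym (demStep-ascent as a b bs a<b))))
  ... | no a≮b  = trans (box-nondescent (reverse bs) b a (reverse as) a≮b)
                        (trans (sym (reverse-adjacent as a b bs)) (cong reverse (sym (demStep-nonascent as a b bs a≮b))))

box-reverse-at : ∀ u m i → 1 ≤ m → 1 ≤ i → m + i ≡ length u → box (reverse u) i ≡ reverse (demStep u m)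
box-reverse-at u m i 1≤m 1≤i m+i≡ with adjacentPairAt m u 1≤m (≤-trans (m<m+n m 1≤i) (≤-reflexive m+i≡))
... | adjacentPair as a b bs = subst (λ k → box (reverse (as ++ a ∷ b ∷ bs)) k ≡ _) (sym i≡) (box-reverse as a b bs)
  where
  i≡ : i ≡ suc (length bs)
  i≡ = +-cancelˡ-≡ (suc (length as)) i (suc (length bs))
         (trans m+i≡ (trans (length-++ as) (+-suc (length as) (suc (length bs)))))

demStep-preserves : ∀ (R : List ℕ → Set) v m → R (swapAt m v) → R v → R (demStep v m)
demStep-preserves R v m r-swap r with ⌊ len v <? len (swapAt m v) ⌋
... | true  = r-swap
... | false = r

demStep-↭ : ∀ v m → demStep v m ↭ v
demStep-↭ v m = demStep-preserves (_↭ v) v m (swapAt-↭ m v) ↭-refl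

foldl-demStep-↭ : ∀ ls v → foldl demStep v ls ↭ v
foldl-demStep-↭ []       v = ↭-refl
foldl-demStep-↭ (x ∷ ls) v = ↭-trans (foldl-demStep-↭ ls (demStep v x)) (demStep-↭ v x)

length-swapAt : ∀ m v → length (swapAt m v) ≡ length v
length-swapAt m v = ↭-length (swapAt-↭ m v)

at-swapAt : ∀ m v → 1 ≤ m → m < length v →
            at (swapAt m v) m ≡ at v (suc m) × at (swapAt m v) (suc m) ≡ at v m
at-swapAt m v 1≤m m<v with adjacentPairAt m v 1≤m m<v
... | adjacentPair as a b bs rewrite swapAt-adjacent as a b bs =
  trans (at-adjacent₁ as b a bs) (sym (at-adjacent₂ as a b bs)) ,
  trans (at-adjacent₂ as b a bs) (sym (at-adjacent₁ as a b bs))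

-- Counting entries in a prefix

countPrefix : (ℕ → Bool) → ℕ → List ℕ → ℕ
countPrefix p zero    xs       = 0
countPrefix p (suc L) []       = 0
countPrefix p (suc L) (x ∷ xs) = if p x then suc (countPrefix p L xs) else countPrefix p L xs

isValue : ℕ → ℕ → Bool
isValue y x = does (x ≟ y)

isAtMost : ℕ → ℕ → Bool
isAtMost b x = does (x ≤? b)

countPrefix-swapAt : ∀ p m L v → m ≢ L → countPrefix p L (swapAt m v) ≡ countPrefix p L v
countPrefix-swapAt p m             zero          v           _   = refl
countPrefix-swapAt p zero          (suc L)       v           _   = refl
countPrefix-swapAt p (suc zero)    (suc L)       []          _   = refl
countPrefix-swapAt p (suc zero)    (suc L)       (a ∷ [])    _   = refl
countPrefix-swapAt p (suc zero)    (suc zero)    (a ∷ b ∷ v) 1≢1 = ⊥-elim (1≢1 refl)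
countPrefix-swapAt p (suc zero)    (suc (suc L)) (a ∷ b ∷ v) _   with p a | p b
... | true  | true  = refl
... | true  | false = refl
... | false | true  = refl
... | false | false = refl
countPrefix-swapAt p (suc (suc m)) (suc L)       []          _   = refl
countPrefix-swapAt p (suc (suc m)) (suc L)       (x ∷ v)     m≢L =
  cong (λ c → if p x then suc c else c) (countPrefix-swapAt p (suc m) L v (m≢L ∘′ cong suc))

countPrefix-foldl : ∀ p L ls v → All (_≢ L) ls → countPrefix p L (foldl demStep v ls) ≡ countPrefix p L v
countPrefix-foldl p L []       v []           = refl
countPrefix-foldl p L (x ∷ ls) v (x≢L ∷ ls≢L) =
  trans (countPrefix-foldl p L ls (demStep v x) ls≢L)
        (demStep-preserves (λ u → countPrefix p L u ≡ countPrefix p L v) v x (countPrefix-swapAt p x L v x≢L) refl)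

countPrefix-mono : ∀ p {L M} v → L ≤ M → countPrefix p L v ≤ countPrefix p M v
countPrefix-mono p v       z≤n       = z≤n
countPrefix-mono p []      (s≤s L≤M) = z≤n
countPrefix-mono p (x ∷ v) (s≤s L≤M) with p x
... | true  = s≤s (countPrefix-mono p v L≤M)
... | false = countPrefix-mono p v L≤M

countPrefix-suc-≤ : ∀ p L v → countPrefix p (suc L) v ≤ suc (countPrefix p L v)
countPrefix-suc-≤ p L       []      = z≤n
countPrefix-suc-≤ p zero    (x ∷ v) with p x
... | true  = ≤-refl
... | false = z≤n
countPrefix-suc-≤ p (suc L) (x ∷ v) with p x
... | true  = s≤s (countPrefix-suc-≤ p L v)
... | false = countPrefix-suc-≤ p L v

countPrefix-suc-false : ∀ p K v → suc K ≤ length v → p (at v (suc K)) ≡ false →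
                        countPrefix p (suc K) v ≡ countPrefix p K v
countPrefix-suc-false p zero    (x ∷ v) _ px≡false rewrite px≡false = refl
countPrefix-suc-false p (suc K) (x ∷ v) (s≤s K<v) pv≡false with p x
... | true  = cong suc (countPrefix-suc-false p K v K<v pv≡false)
... | false = countPrefix-suc-false p K v K<v pv≡false

countPrefix-positive : ∀ p L v k → 1 ≤ k → k ≤ L → k ≤ length v → p (at v k) ≡ true → 1 ≤ countPrefix p L v
countPrefix-positive p (suc L) (x ∷ v) (suc zero) _ _ _ px≡true rewrite px≡true = s≤s z≤n
countPrefix-positive p (suc L) (x ∷ v) (suc (suc k)) _ (s≤s k<L) (s≤s k<v) pv≡true with p x
... | true  = s≤s z≤n
... | false = countPrefix-positive p L v (suc k) (s≤s z≤n) k<L k<v pv≡true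

countPrefix-none : ∀ p L v → (∀ k → 1 ≤ k → k ≤ L → p (at v k) ≡ false) → countPrefix p L v ≡ 0
countPrefix-none p zero    v       _    = refl
countPrefix-none p (suc L) []      _    = refl
countPrefix-none p (suc L) (x ∷ v) none rewrite none 1 ≤-refl (s≤s z≤n) =
  countPrefix-none p L v (λ { (suc k) _ k≤L → none (suc (suc k)) (s≤s z≤n) (s≤s k≤L) })

countPrefix-all : ∀ p L v → L ≤ length v → (∀ k → 1 ≤ k → k ≤ L → p (at v k) ≡ true) → countPrefix p L v ≡ L
countPrefix-all p zero    v       _         _   = refl
countPrefix-all p (suc L) (x ∷ v) (s≤s L≤v) all rewrite all 1 ≤-refl (s≤s z≤n) =
  cong suc (countPrefix-all p L v L≤v (λ { (suc k) _ k≤L → all (suc (suc k)) (s≤s z≤n) (s≤s k≤L) }))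

private
  above-≢ : ∀ {L x} {ls : List ℕ} → L < x → All (x <_) ls → All (_≢ L) (x ∷ ls)
  above-≢ L<x x<ls = >⇒≢ L<x ∷ All.map (λ x<y → >⇒≢ (<-trans L<x x<y)) x<ls

-- Letters ≤ L only permute the first L + 1 entries; once a letter exceeds L, so do all later
-- ones, and the first L entries stay fixed.
countPrefix-foldl-lower : ∀ p L ls v → AllPairs _<_ ls →
                          countPrefix p (suc L) v ≤ suc (countPrefix p L (foldl demStep v ls))
countPrefix-foldl-lower p L []       v _               = countPrefix-suc-≤ p L v
countPrefix-foldl-lower p L (x ∷ ls) v (x<ls ∷ ls↑) with x ≤? L
... | yes x≤L = ≤-trans (≤-reflexive (sym (countPrefix-foldl p (suc L) (x ∷ []) v (<⇒≢ (s≤s x≤L) ∷ []))))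
                        (countPrefix-foldl-lower p L ls (demStep v x) ls↑)
... | no x≰L  = ≤-trans (countPrefix-suc-≤ p L v)
                        (s≤s (≤-reflexive (sym (countPrefix-foldl p L (x ∷ ls) v (above-≢ (≰⇒> x≰L) x<ls)))))

countPrefix-foldl-upper : ∀ p L ls v → AllPairs _<_ ls →
                          countPrefix p L (foldl demStep v ls) ≤ countPrefix p (suc L) v
countPrefix-foldl-upper p L []       v _               = countPrefix-mono p v (n≤1+n L)
countPrefix-foldl-upper p L (x ∷ ls) v (x<ls ∷ ls↑) with x ≤? L
... | yes x≤L = ≤-trans (countPrefix-foldl-upper p L ls (demStep v x) ls↑)
                        (≤-reflexive (countPrefix-foldl p (suc L) (x ∷ []) v (<⇒≢ (s≤s x≤L) ∷ [])))
... | no x≰L  = ≤-trans (≤-reflexive (countPrefix-foldl p L (x ∷ ls) v (above-≢ (≰⇒> x≰L) x<ls)))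
                        (countPrefix-mono p v (n≤1+n L))

-- Permutations stabilising an initial segment

Unique-resp-↭ : ∀ {A : Set} {xs ys : List A} → xs ↭ ys → Unique xs → Unique ys
Unique-resp-↭ {A} xs↭ys = PermProperties.Unique-resp-↭ (setoid A) (↭⇒↭ₛ xs↭ys)

at-applyUpTo : ∀ (f : ℕ → ℕ) n k → k < n → at (applyUpTo f n) (suc k) ≡ f k
at-applyUpTo f (suc n) zero    _         = refl
at-applyUpTo f (suc n) (suc k) (s≤s k<n) = at-applyUpTo (f ∘′ suc) n k k<n

at-idPerm : ∀ n k → 1 ≤ k → k ≤ n → at (idPerm n) k ≡ k
at-idPerm n (suc k) _ k<n = trans (cong (λ v → at v (suc k)) (map-upTo suc n)) (at-applyUpTo suc n k k<n)

length-idPerm : ∀ n → length (idPerm n) ≡ n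
length-idPerm n = trans (length-map suc (upTo n)) (length-upTo n)

Unique-idPerm : ∀ n → Unique (idPerm n)
Unique-idPerm n = Unique.map⁺ suc-injective (Unique.upTo⁺ n)

-- For a permutation v: v maps {1, …, s} onto itself.
Stabilises : ℕ → List ℕ → Set
Stabilises s v = ∀ k → 1 ≤ k → k ≤ length v → (k ≤ s ⇔ at v k ≤ s)

Stabilises-idPerm : ∀ s n → Stabilises s (idPerm n)
Stabilises-idPerm s n k 1≤k k≤n rewrite at-idPerm n k 1≤k (≤-trans k≤n (≤-reflexive (length-idPerm n))) = ⇔.refl

Stabilises-swapAt : ∀ s m v → m ≢ s → 1 ≤ m → m < length v → Stabilises s v → Stabilises s (swapAt m v)
Stabilises-swapAt s m v m≢s 1≤m m<v stab k 1≤k k≤v rewrite length-swapAt m v with k ≟ m | k ≟ suc m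
... | yes refl | _ = subst (λ x → (k ≤ s) ⇔ (x ≤ s)) (sym (proj₁ (at-swapAt m v 1≤m m<v)))
                          (⇔.trans m≤s⇔m<s (stab (suc m) (s≤s z≤n) m<v))
  where m≤s⇔m<s : (m ≤ s) ⇔ (suc m ≤ s)
        m≤s⇔m<s = mk⇔ (λ m≤s → ≤∧≢⇒< m≤s m≢s) <⇒≤
... | no _ | yes refl = subst (λ x → (suc m ≤ s) ⇔ (x ≤ s)) (sym (proj₂ (at-swapAt m v 1≤m m<v)))
                             (⇔.trans m<s⇔m≤s (stab m 1≤m (<⇒≤ m<v)))
  where m<s⇔m≤s : (suc m ≤ s) ⇔ (m ≤ s)
        m<s⇔m≤s = mk⇔ <⇒≤ (λ m≤s → ≤∧≢⇒< m≤s m≢s)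
... | no k≢m | no k≢m+1 = subst (λ x → (k ≤ s) ⇔ (x ≤ s)) (sym (at-swapAt-other m v k k≢m k≢m+1)) (stab k 1≤k k≤v)

Stabilises-low : ∀ {s k} v → Stabilises s v → 1 ≤ k → k ≤ s → k ≤ length v → at v k ≤ s
Stabilises-low v stab 1≤k k≤s k≤v = Equivalence.to (stab _ 1≤k k≤v) k≤s

Stabilises-high : ∀ {s k} v → Stabilises s v → s < k → k ≤ length v → s < at v k
Stabilises-high v stab s<k k≤v =
  ≰⇒> (λ v≤s → <⇒≱ s<k (Equivalence.from (stab _ (≤-trans (s≤s z≤n) s<k) k≤v) v≤s))

-- Both entries at m and m + 1 exceed s, and afterwards position m holds the larger of them,
-- which is s + 1 only if both are.
demStep-avoids : ∀ s m v → s < m → m < length v → Unique v → Stabilises s v → at (demStep v m) m ≢ suc s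
demStep-avoids s m v s<m m<v uniq stab with adjacentPairAt m v (≤-trans (s≤s z≤n) s<m) m<v
... | adjacentPair as a b bs with a <? b
...   | yes a<b = λ b≡s+1 → <-irrefl (sym b≡s+1) (≤-<-trans s<a a<b′)
  where
  s<a : s < a
  s<a = subst (s <_) (at-adjacent₁ as a b bs) (Stabilises-high (as ++ a ∷ b ∷ bs) stab s<m (<⇒≤ m<v))
  a<b′ : a < at (demStep (as ++ a ∷ b ∷ bs) (suc (length as))) (suc (length as))
  a<b′ = subst (a <_) (sym (trans (cong (λ u → at u (suc (length as))) (demStep-ascent as a b bs a<b))
                                  (at-adjacent₁ as b a bs))) a<b
...   | no a≮b rewrite demStep-nonascent as a b bs a≮b | at-adjacent₁ as a b bs = λ a≡s+1 →
  Unique-adjacent as a b bs uniq (≤-antisym (subst (_≤ b) (sym a≡s+1) s<b) (≮⇒≥ a≮b))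
  where
  s<b : s < b
  s<b = subst (s <_) (at-adjacent₂ as a b bs) (Stabilises-high (as ++ a ∷ b ∷ bs) stab (≤-trans s<m (n≤1+n _)) m<v)

Stabilises-demStep : ∀ s v m → m ≢ s → 1 ≤ m → m < length v → Stabilises s v → Stabilises s (demStep v m)
Stabilises-demStep s v m m≢s 1≤m m<v stab =
  demStep-preserves (Stabilises s) v m (Stabilises-swapAt s m v m≢s 1≤m m<v stab) stab

Stabilises-foldl : ∀ s n ls v → All (λ x → x ≢ s × 1 ≤ x × x < n) ls → length v ≡ n →
                   Stabilises s v → Stabilises s (foldl demStep v ls)
Stabilises-foldl s n []       v []                          _    stab = stab
Stabilises-foldl s n (x ∷ ls) v ((x≢s , 1≤x , x<n) ∷ ls-ok) v≡n stab =
  Stabilises-foldl s n ls (demStep v x) ls-ok (trans (↭-length (demStep-↭ v x)) v≡n)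
    (Stabilises-demStep s v x x≢s 1≤x (≤-trans x<n (≤-reflexive (sym v≡n))) stab)

ascending : ℕ → ℕ → List ℕ
ascending e zero    = []
ascending e (suc k) = e ∷ ascending (suc e) k

ascending-bounds : ∀ e k → All (λ r → e ≤ r × r < e + k) (ascending e k)
ascending-bounds e zero    = []
ascending-bounds e (suc k) =
  (≤-refl , m<m+n e (s≤s z≤n)) ∷
  All.map (λ { (e<r , r<) → <⇒≤ e<r , ≤-trans r< (≤-reflexive (sym (+-suc e k))) }) (ascending-bounds (suc e) k)

ascending-increasing : ∀ e k → AllPairs _<_ (ascending e k)
ascending-increasing e zero    = []
ascending-increasing e (suc k) = All.map proj₁ (ascending-bounds (suc e) k) ∷ ascending-increasing (suc e) k

ascending-++ : ∀ e a b → ascending e (a + b) ≡ ascending e a ++ ascending (e + a) b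
ascending-++ e zero    b = cong (λ e′ → ascending e′ b) (sym (+-identityʳ e))
ascending-++ e (suc a) b =
  cong (e ∷_) (trans (ascending-++ (suc e) a b) (cong (λ e′ → ascending (suc e) a ++ ascending e′ b) (sym (+-suc e a))))

applyUpTo-ascending : ∀ (f : ℕ → ℕ) e k → (∀ x → f x ≡ e + x) → applyUpTo f k ≡ ascending e k
applyUpTo-ascending f e zero    f≡ = refl
applyUpTo-ascending f e (suc k) f≡ =
  cong₂ _∷_ (trans (f≡ 0) (+-identityʳ e))
            (applyUpTo-ascending (f ∘′ suc) (suc e) k (λ x → trans (f≡ (suc x)) (+-suc e x)))

countPrefix-sweep : ∀ s t K v → s ≤ K → K + t < length v → Unique v → Stabilises s v →
                    countPrefix (isValue (suc s)) K v ≡ 0 →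
                    countPrefix (isValue (suc s)) (K + t) (foldl demStep v (ascending (suc K) t)) ≡ 0
countPrefix-sweep s zero    K v _   _     _    _    none =
  trans (cong (λ L → countPrefix (isValue (suc s)) L v) (+-identityʳ K)) none
countPrefix-sweep s (suc t) K v s≤K K+t<v uniq stab none =
  subst (λ L → countPrefix p L (foldl demStep v′ (ascending (suc (suc K)) t)) ≡ 0) (sym (+-suc K t))
    (countPrefix-sweep s t (suc K) v′ (≤-trans s≤K (n≤1+n K)) K+t<v′
       (Unique-resp-↭ (↭-sym (demStep-↭ v (suc K))) uniq)
       (Stabilises-demStep s v (suc K) (>⇒≢ (s≤s s≤K)) (s≤s z≤n) K<v stab)
       none′)
  where
  v′ : List ℕ
  v′ = demStep v (suc K)
  p : ℕ → Bool
  p = isValue (suc s)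
  K<v : suc K < length v
  K<v = ≤-<-trans (≤-trans (s≤s (m≤m+n K t)) (≤-reflexive (sym (+-suc K t)))) K+t<v
  K+t<v′ : suc K + t < length v′
  K+t<v′ = subst₂ _<_ (+-suc K t) (sym (↭-length (demStep-↭ v (suc K)))) K+t<v
  none′ : countPrefix p (suc K) v′ ≡ 0
  none′ = begin
    countPrefix p (suc K) v′
      ≡⟨ countPrefix-suc-false p K v′ (≤-trans (<⇒≤ K<v) (≤-reflexive (sym (↭-length (demStep-↭ v (suc K))))))
           (dec-false (at v′ (suc K) ≟ suc s) (demStep-avoids s (suc K) v (s≤s s≤K) K<v uniq stab)) ⟩
    countPrefix p K v′
      ≡⟨ countPrefix-foldl p K (suc K ∷ []) v (>⇒≢ ≤-refl ∷ []) ⟩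
    countPrefix p K v
      ≡⟨ none ⟩
    0 ∎
    where open ≡-Reasoning

-- Pipe dreams, column by column

rowsTB-ascending : ∀ n c → rowsTB n c ≡ ascending 1 (n ∸ c)
rowsTB-ascending n c = trans (map-upTo suc (n ∸ c)) (applyUpTo-ascending suc 1 (n ∸ c) (λ _ → refl))

rowsTB-bounds : ∀ n c → All (λ r → 1 ≤ r × r + c ≤ n) (rowsTB n c)
rowsTB-bounds n c = subst (All _) (sym (rowsTB-ascending n c)) (All.map fits (ascending-bounds 1 (n ∸ c)))
  where
  fits : ∀ {r} → 1 ≤ r × r < 1 + (n ∸ c) → 1 ≤ r × r + c ≤ n
  fits (1≤r , s≤s r≤) = 1≤r , m≤o∸n⇒m+n≤o _ c≤n r≤
    where
    c≤n : c ≤ n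
    c≤n = <⇒≤ (m∸n≢0⇒n<m (λ n∸c≡0 → <⇒≱ 1≤r (≤-trans r≤ (≤-reflexive n∸c≡0))))

select : (ℕ → Bool) → (ℕ → ℕ) → List ℕ → List ℕ
select b g = concatMap (λ r → if b r then g r ∷ [] else [])

select-All : ∀ {Q : ℕ → Set} b g rs → All (λ r → b r ≡ true → Q (g r)) rs → All Q (select b g rs)
select-All b g []       []       = []
select-All b g (r ∷ rs) (q ∷ qs) with b r
... | true  = q refl ∷ select-All b g rs qs
... | false = select-All b g rs qs

select-increasing : ∀ b g rs → AllPairs (λ r r′ → g r < g r′) rs → AllPairs _<_ (select b g rs)
select-increasing b g []       []           = []
select-increasing b g (r ∷ rs) (r< ∷ rs↑) with b r
... | true  = select-All b g rs (All.map (λ lt _ → lt) r<) ∷ select-increasing b g rs rs↑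
... | false = select-increasing b g rs rs↑

select-ascending : ∀ b c e k → All (λ r → b r ≡ true) (ascending (suc e) k) →
                   select b (λ r → r + c ∸ 1) (ascending (suc e) k) ≡ ascending (e + c) k
select-ascending b c e zero    []         = refl
select-ascending b c e (suc k) (be ∷ bes) rewrite be =
  cong ((e + c) ∷_) (select-ascending b c (suc e) k bes)

concatMap-none : ∀ (F : ℕ → List ℕ) l → All (λ a → F a ≡ []) l → concatMap F l ≡ []
concatMap-none F []      []          = refl
concatMap-none F (a ∷ l) (Fa≡[] ∷ rest) rewrite Fa≡[] = concatMap-none F l rest

select-cong : ∀ {b b′ : ℕ → Bool} g rs → (∀ r → b r ≡ b′ r) → select b g rs ≡ select b′ g rs
select-cong g rs b≗b′ = concatMap-cong (λ r → cong (λ β → if β then g r ∷ [] else []) (b≗b′ r)) rs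

select-none : ∀ b g rs → All (λ r → b r ≡ false) rs → select b g rs ≡ []
select-none b g rs none =
  concatMap-none _ rs (All.map (λ br≡false → cong (λ β → if β then g _ ∷ [] else []) br≡false) none)

module Columns (n : ℕ) (P : List Cell) where

  columnWord : ℕ → List ℕ
  columnWord c = select (λ r → memb (r , c) P) (λ r → r + c ∸ 1) (rowsTB n c)

  column : ℕ → List ℕ → List ℕ
  column c v = foldl demStep v (columnWord c)

  -- δP n P is, by definition, columns (n ∸ 1) (idPerm n).
  columns : ℕ → List ℕ → List ℕ
  columns m v = foldl demStep v (concatMap columnWord (map suc (downFrom m)))

  columns-suc : ∀ m v → columns (suc m) v ≡ columns m (column (suc m) v)
  columns-suc m v = foldl-++ demStep v (columnWord (suc m)) _

  private
    letter≡ : ∀ r c′ → r + suc c′ ∸ 1 ≡ r + c′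
    letter≡ r c′ = cong (_∸ 1) (+-suc r c′)

  columnWord-increasing : ∀ c′ → AllPairs _<_ (columnWord (suc c′))
  columnWord-increasing c′ = select-increasing _ _ (rowsTB n (suc c′))
    (subst (AllPairs _) (sym (rowsTB-ascending n (suc c′)))
      (AllPairs.map (λ {r} {r′} r<r′ → subst₂ _<_ (sym (letter≡ r c′)) (sym (letter≡ r′ c′)) (+-monoˡ-< c′ r<r′))
                    (ascending-increasing 1 _)))

  columnWord-letters : ∀ c′ → All (λ x → c′ < x × x < n) (columnWord (suc c′))
  columnWord-letters c′ = select-All _ _ (rowsTB n (suc c′)) (All.map bounds (rowsTB-bounds n (suc c′)))
    where
    bounds : ∀ {r} → 1 ≤ r × r + suc c′ ≤ n → memb (r , suc c′) P ≡ true → c′ < r + suc c′ ∸ 1 × r + suc c′ ∸ 1 < n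
    bounds {r} (1≤r , fits) _ rewrite letter≡ r c′ = +-monoˡ-≤ c′ 1≤r , subst (_≤ n) (+-suc r c′) fits

  columnWord-without : ∀ a c′ → memb (a , suc c′) P ≡ false → All (_≢ a + c′) (columnWord (suc c′))
  columnWord-without a c′ a∉P = select-All _ _ (rowsTB n (suc c′)) (All.universal other _)
    where
    other : ∀ r → memb (r , suc c′) P ≡ true → r + suc c′ ∸ 1 ≢ a + c′
    other r r∈P eq with +-cancelʳ-≡ c′ r a (trans (sym (letter≡ r c′)) eq)
    ... | refl = case trans (sym r∈P) a∉P of λ ()

  columnWord-prefix : ∀ i j′ → i + suc j′ ≤ n → (∀ r → 1 ≤ r → r ≤ i → memb (r , suc j′) P ≡ true) →
    Σ (List ℕ) λ rest → columnWord (suc j′) ≡ ascending (suc j′) i ++ rest × All (i + j′ <_) rest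
  columnWord-prefix i j′ fits top = select b g (ascending (suc i) k) , word≡ , high
    where
    b : ℕ → Bool
    b r = memb (r , suc j′) P
    g : ℕ → ℕ
    g r = r + suc j′ ∸ 1
    k : ℕ
    k = n ∸ suc j′ ∸ i
    rows≡ : rowsTB n (suc j′) ≡ ascending 1 i ++ ascending (suc i) k
    rows≡ = trans (rowsTB-ascending n (suc j′))
                  (trans (cong (ascending 1) (sym (m+[n∸m]≡n (m+n≤o⇒m≤o∸n i fits)))) (ascending-++ 1 i k))
    word≡ : columnWord (suc j′) ≡ ascending (suc j′) i ++ select b g (ascending (suc i) k)
    word≡ = begin
      select b g (rowsTB n (suc j′))                              ≡⟨ cong (select b g) rows≡ ⟩
      select b g (ascending 1 i ++ ascending (suc i) k)           ≡⟨ concatMap-++ _ (ascending 1 i) _ ⟩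
      select b g (ascending 1 i) ++ select b g (ascending (suc i) k)
        ≡⟨ cong (_++ select b g (ascending (suc i) k)) (select-ascending b (suc j′) 0 i
             (All.map (λ { (1≤r , s≤s r≤i) → top _ 1≤r r≤i }) (ascending-bounds 1 i))) ⟩
      ascending (suc j′) i ++ select b g (ascending (suc i) k)    ∎
      where open ≡-Reasoning
    high : All (i + j′ <_) (select b g (ascending (suc i) k))
    high = select-All b g _
      (All.map (λ { {r} (i<r , _) _ → subst (i + j′ <_) (sym (letter≡ r j′)) (+-monoˡ-≤ j′ i<r) })
                                     (ascending-bounds (suc i) k))

  columns-above : ∀ (R : List ℕ → Set) b → (∀ c v → b < c → R v → R (column c v)) →
                  ∀ m v → b ≤ m → R v → Σ (List ℕ) λ u → R u × columns m v ≡ columns b u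
  columns-above R b step zero    v z≤n r = v , r , refl
  columns-above R b step (suc m) v b≤m r with m≤n⇒m<n∨m≡n b≤m
  ... | inj₂ refl = v , r , refl
  ... | inj₁ b<m with columns-above R b step m (column (suc m) v) (≤-pred b<m) (step (suc m) v b<m r)
  ...   | u , ru , eq = u , ru , trans (columns-suc m v) eq

  countPrefix-columns-lower : ∀ p L m v → countPrefix p (L + m) v ≤ m + countPrefix p L (columns m v)
  countPrefix-columns-lower p L zero    v = ≤-reflexive (cong (λ L′ → countPrefix p L′ v) (+-identityʳ L))
  countPrefix-columns-lower p L (suc m) v = begin
    countPrefix p (L + suc m) v
      ≡⟨ cong (λ L′ → countPrefix p L′ v) (+-suc L m) ⟩
    countPrefix p (suc (L + m)) v
      ≤⟨ countPrefix-foldl-lower p (L + m) (columnWord (suc m)) v (columnWord-increasing m) ⟩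
    suc (countPrefix p (L + m) (column (suc m) v))
      ≤⟨ s≤s (countPrefix-columns-lower p L m (column (suc m) v)) ⟩
    suc m + countPrefix p L (columns m (column (suc m) v))
      ≡⟨ cong (λ u → suc m + countPrefix p L u) (columns-suc m v) ⟨
    suc m + countPrefix p L (columns (suc m) v) ∎
    where open ≤-Reasoning

  countPrefix-columns-upper : ∀ p L m v → countPrefix p L (columns m v) ≤ countPrefix p (L + m) v
  countPrefix-columns-upper p L zero    v = ≤-reflexive (cong (λ L′ → countPrefix p L′ v) (sym (+-identityʳ L)))
  countPrefix-columns-upper p L (suc m) v = begin
    countPrefix p L (columns (suc m) v)
      ≡⟨ cong (countPrefix p L) (columns-suc m v) ⟩
    countPrefix p L (columns m (column (suc m) v))
      ≤⟨ countPrefix-columns-upper p L m (column (suc m) v) ⟩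
    countPrefix p (L + m) (column (suc m) v)
      ≤⟨ countPrefix-foldl-upper p (L + m) (columnWord (suc m)) v (columnWord-increasing m) ⟩
    countPrefix p (suc (L + m)) v
      ≡⟨ cong (λ L′ → countPrefix p L′ v) (+-suc L m) ⟨
    countPrefix p (L + suc m) v ∎
    where open ≤-Reasoning

  -- Column b leaves the count at a + b − 1 unchanged since (a, b) ∉ P, and each later
  -- column lowers the prefix length by one at the cost of at most one small value.
  small-value-in-prefix : ∀ a b′ → 1 ≤ a → a + suc b′ ≤ n → memb (a , suc b′) P ≡ false →
                          1 ≤ countPrefix (isAtMost (suc b′)) a (δP n P)
  small-value-in-prefix a b′ 1≤a fits a∉P =
    conclude (columns-above R (suc b′) step (n ∸ 1) (idPerm n) b≤n∸1 (≤-reflexive (sym initial)))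
    where
    p : ℕ → Bool
    p = isAtMost (suc b′)
    R : List ℕ → Set
    R v = suc b′ ≤ countPrefix p (suc b′) v
    step : ∀ c v → suc b′ < c → R v → R (column c v)
    step (suc c′) v (s≤s b≤c′) r =
      subst (suc b′ ≤_) (sym (countPrefix-foldl p (suc b′) _ v
        (All.map (λ { (c′<x , _) → >⇒≢ (≤-<-trans b≤c′ c′<x) }) (columnWord-letters c′)))) r
    b≤n : suc b′ ≤ n
    b≤n = ≤-trans (m≤n+m (suc b′) a) fits
    b≤n∸1 : suc b′ ≤ n ∸ 1
    b≤n∸1 = m+n≤o⇒m≤o∸n (suc b′) (subst (_≤ n) (+-comm 1 (suc b′)) (≤-trans (+-monoˡ-≤ (suc b′) 1≤a) fits))
    initial : countPrefix p (suc b′) (idPerm n) ≡ suc b′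
    initial = countPrefix-all p (suc b′) (idPerm n) (≤-trans b≤n (≤-reflexive (sym (length-idPerm n))))
      λ k 1≤k k≤b → subst (λ x → p x ≡ true) (sym (at-idPerm n k 1≤k (≤-trans k≤b b≤n))) (dec-true (k ≤? suc b′) k≤b)
    conclude : Σ (List ℕ) (λ u → R u × δP n P ≡ columns (suc b′) u) → 1 ≤ countPrefix p a (δP n P)
    conclude (u , b≤u , δP≡) = subst (λ v → 1 ≤ countPrefix p a v) (sym δP≡) (+-cancelˡ-≤ b′ 1 _ (begin
      b′ + 1
        ≡⟨ +-comm b′ 1 ⟩
      suc b′
        ≤⟨ b≤u ⟩
      countPrefix p (suc b′) u
        ≤⟨ countPrefix-mono p u (+-monoˡ-≤ b′ 1≤a) ⟩
      countPrefix p (a + b′) u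
        ≡⟨ countPrefix-foldl p (a + b′) (columnWord (suc b′)) u (columnWord-without a b′ a∉P) ⟨
      countPrefix p (a + b′) (column (suc b′) u)
        ≤⟨ countPrefix-columns-lower p a b′ (column (suc b′) u) ⟩
      b′ + countPrefix p a (columns b′ (column (suc b′) u))
        ≡⟨ cong (λ v → b′ + countPrefix p a v) (columns-suc b′ u) ⟨
      b′ + countPrefix p a (columns (suc b′) u) ∎))
      where open ≤-Reasoning

  -- The letters j, …, j + i − 1 of the top cells of column j extend, one position at a time, the
  -- prefix that avoids the value j (demStep-avoids).
  column-keeps-value-out : ∀ i j′ u → i + suc j′ ≤ n → (∀ r → 1 ≤ r → r ≤ i → memb (r , suc j′) P ≡ true) →
    length u ≡ n → Unique u → Stabilises j′ u → countPrefix (isValue (suc j′)) (i + j′) (column (suc j′) u) ≡ 0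
  column-keeps-value-out i j′ u fits top u≡n uniq stab with columnWord-prefix i j′ fits top
  ... | rest , word≡ , rest-high = begin
    countPrefix p (i + j′) (column (suc j′) u)
      ≡⟨ cong (countPrefix p (i + j′)) (trans (cong (foldl demStep u) word≡) (foldl-++ demStep u top-word rest)) ⟩
    countPrefix p (i + j′) (foldl demStep (foldl demStep u top-word) rest)
      ≡⟨ countPrefix-foldl p (i + j′) rest _ (All.map >⇒≢ rest-high) ⟩
    countPrefix p (i + j′) (foldl demStep u top-word)
      ≡⟨ cong (λ L → countPrefix p L (foldl demStep u top-word)) (+-comm i j′) ⟩
    countPrefix p (j′ + i) (foldl demStep u top-word)
      ≡⟨ countPrefix-sweep j′ i j′ u ≤-refl j′+i<u uniq stab initial ⟩
    0 ∎
    where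
    open ≡-Reasoning
    p : ℕ → Bool
    p = isValue (suc j′)
    top-word : List ℕ
    top-word = ascending (suc j′) i
    j′+i<u : j′ + i < length u
    j′+i<u = subst₂ _≤_ (cong suc (+-comm i j′)) (sym u≡n) (subst (_≤ n) (+-suc i j′) fits)
    initial : countPrefix p j′ u ≡ 0
    initial = countPrefix-none p j′ u (λ k 1≤k k≤j′ → dec-false (at u k ≟ suc j′) λ uk≡j →
      <-irrefl uk≡j (s≤s (Stabilises-low u stab 1≤k k≤j′ (≤-trans k≤j′ (≤-trans (m≤m+n j′ i) (<⇒≤ j′+i<u))))))

  -- The columns right of j keep the values {1, …, j − 1} in the first j − 1 positions.
  value-absent-from-prefix : ∀ i j′ → 1 ≤ i → i + suc j′ ≤ n → (∀ r → 1 ≤ r → r ≤ i → memb (r , suc j′) P ≡ true) →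
                             countPrefix (isValue (suc j′)) i (δP n P) ≡ 0
  value-absent-from-prefix i j′ 1≤i fits top =
    conclude (columns-above R (suc j′) step (n ∸ 1) (idPerm n) j≤n∸1 (↭-refl , Stabilises-idPerm j′ n))
    where
    p : ℕ → Bool
    p = isValue (suc j′)
    length≡ : ∀ {v} → v ↭ idPerm n → length v ≡ n
    length≡ v↭ = trans (↭-length v↭) (length-idPerm n)
    R : List ℕ → Set
    R v = v ↭ idPerm n × Stabilises j′ v
    step : ∀ c v → suc j′ < c → R v → R (column c v)
    step (suc c′) v (s≤s j≤c′) (v↭ , stab) =
      ↭-trans (foldl-demStep-↭ (columnWord (suc c′)) v) v↭ ,
      Stabilises-foldl j′ n (columnWord (suc c′)) v
        (All.map (λ { (c′<x , x<n) → >⇒≢ (<-trans j≤c′ c′<x) , ≤-trans (s≤s z≤n) c′<x , x<n }) (columnWord-letters c′))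
        (length≡ v↭) stab
    j≤n∸1 : suc j′ ≤ n ∸ 1
    j≤n∸1 = m+n≤o⇒m≤o∸n (suc j′) (subst (_≤ n) (+-comm 1 (suc j′)) (≤-trans (+-monoˡ-≤ (suc j′) 1≤i) fits))
    conclude : Σ (List ℕ) (λ u → R u × δP n P ≡ columns (suc j′) u) → countPrefix p i (δP n P) ≡ 0
    conclude (u , (u↭ , stab) , δP≡) = n≤0⇒n≡0 (begin
      countPrefix p i (δP n P)
        ≡⟨ cong (countPrefix p i) (trans δP≡ (columns-suc j′ u)) ⟩
      countPrefix p i (columns j′ (column (suc j′) u))
        ≤⟨ countPrefix-columns-upper p i j′ (column (suc j′) u) ⟩
      countPrefix p (i + j′) (column (suc j′) u)
        ≡⟨ column-keeps-value-out i j′ u fits top (length≡ u↭) (Unique-resp-↭ (↭-sym u↭) (Unique-idPerm n)) stab ⟩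
      0 ∎)
      where open ≤-Reasoning

-- Co-pipe dreams

≡ᵇ-refl : ∀ m → (m ≡ᵇ m) ≡ true
≡ᵇ-refl m = Equivalence.to T-≡ (≡⇒≡ᵇ m m refl)

-- memb c is, by definition, any (isCell c).
isCell : Cell → Cell → Bool
isCell (i , j) c = (proj₁ c ≡ᵇ i) ∧ (proj₂ c ≡ᵇ j)

isCell-refl : ∀ c → isCell c c ≡ true
isCell-refl (i , j) = cong₂ _∧_ (≡ᵇ-refl i) (≡ᵇ-refl j)

isCell-true : ∀ c d → isCell c d ≡ true → d ≡ c
isCell-true (i , j) (a , b) eq with (a ≡ᵇ i) in a≡i | (b ≡ᵇ j) in b≡j
... | true | true = cong₂ _,_ (≡ᵇ⇒≡ a i (Equivalence.from T-≡ a≡i)) (≡ᵇ⇒≡ b j (Equivalence.from T-≡ b≡j))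

any-cong : ∀ {f g : Cell → Bool} l → (∀ y → f y ≡ g y) → any f l ≡ any g l
any-cong []      _   = refl
any-cong (y ∷ l) f≗g = cong₂ _∨_ (f≗g y) (any-cong l f≗g)

any-false : ∀ {f : Cell → Bool} l → (∀ y → f y ≡ false) → any f l ≡ false
any-false []      _      = refl
any-false (y ∷ l) none rewrite none y = any-false l none

any-true : ∀ {f : Cell → Bool} {y} l → y ∈ l → f y ≡ true → any f l ≡ true
any-true {f} (z ∷ l) (here refl) fy≡true rewrite fy≡true = refl
any-true {f} (z ∷ l) (there y∈l) fy≡true = trans (cong (f z ∨_) (any-true l y∈l fy≡true)) (∨-zeroʳ (f z))

-- coP n X is, by definition, map shift (filter (λ y → T? (not (memb y X))) (cellsT n)).
shift : Cell → Cell
shift c = (proj₁ c + proj₂ c , proj₂ c)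

memb-coP : ∀ n X c → memb c (coP n X) ≡ any (λ y → not (memb y X) ∧ isCell c (shift y)) (cellsT n)
memb-coP n X c = go (cellsT n)
  where
  go : ∀ l → memb c (map shift (filter (λ y → T? (not (memb y X))) l))
           ≡ any (λ y → not (memb y X) ∧ isCell c (shift y)) l
  go []      = refl
  go (y ∷ l) with not (memb y X)
  ... | true  = cong (isCell c (shift y) ∨_) (go l)
  ... | false = go l

coP-outside : ∀ n X a c → memb (a ∸ c , c) X ≡ true → memb (a , c) (coP n X) ≡ false
coP-outside n X a c inX = trans (memb-coP n X (a , c)) (any-false (cellsT n) excluded)
  where
  excluded : ∀ y → (not (memb y X) ∧ isCell (a , c) (shift y)) ≡ false
  excluded (r , c′) with isCell (a , c) (r + c′ , c′) in hit
  ... | false = ∧-zeroʳ _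
  ... | true with isCell-true (a , c) (r + c′ , c′) hit
  ...   | refl rewrite m+n∸n≡m r c′ | inX = refl

coP-complement : ∀ n P i j → (i , j) ∈ cellsT n → memb (i , j) P ≡ false → memb (i + j , j) (coP n P) ≡ true
coP-complement n P i j ij∈T ij∉P =
  trans (memb-coP n P (i + j , j)) (any-true (cellsT n) ij∈T (cong₂ _∧_ (cong not ij∉P) (isCell-refl (i + j , j))))

coP-insert : ∀ n P i j a c → ¬ (a ≡ i + j × c ≡ j) → memb (a , c) (coP n ((i , j) ∷ P)) ≡ memb (a , c) (coP n P)
coP-insert n P i j a c ac≢ =
  trans (memb-coP n ((i , j) ∷ P) (a , c)) (trans (any-cong (cellsT n) same) (sym (memb-coP n P (a , c))))
  where
  same : ∀ y → (not (memb y ((i , j) ∷ P)) ∧ isCell (a , c) (shift y)) ≡ (not (memb y P) ∧ isCell (a , c) (shift y))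
  same y with isCell (a , c) (shift y) in hit
  ... | false = trans (∧-zeroʳ _) (sym (∧-zeroʳ _))
  ... | true with isCell y (i , j) in new
  ...   | false = refl
  ...   | true with isCell-true y (i , j) new | isCell-true (a , c) (shift y) hit
  ...     | refl | refl = ⊥-elim (ac≢ (refl , refl))

∈-cellsT : ∀ n i j → 1 ≤ i → 1 ≤ j → i + j ≤ n → (i , j) ∈ cellsT n
∈-cellsT n (suc i) (suc j) _ _ fits =
  ∈-concatMap⁺ (λ c → map (_, c) (rowsTB n c)) (lose j∈cols (∈-map⁺ (_, suc j) i∈rows))
  where
  i∈rows : suc i ∈ rowsTB n (suc j)
  i∈rows = ∈-map⁺ suc (∈-upTo⁺ (m+n≤o⇒m≤o∸n (suc i) fits))
  j∈cols : suc j ∈ colsRL n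
  j∈cols = ∈-map⁺ suc (∈-downFrom⁺ (m+n≤o⇒m≤o∸n (suc j) j+1≤n))
    where
    j+1≤n : suc j + 1 ≤ n
    j+1≤n = ≤-trans (+-monoʳ-≤ (suc j) (s≤s z≤n)) (subst (_≤ n) (+-comm (suc i) (suc j)) fits)

descending : ℕ → ℕ → List ℕ
descending lo zero    = []
descending lo (suc k) = lo + suc k ∷ descending lo k

descending-bounds : ∀ lo k → All (λ a → lo < a × a ≤ lo + k) (descending lo k)
descending-bounds lo zero    = []
descending-bounds lo (suc k) =
  (m<m+n lo (s≤s z≤n) , ≤-refl) ∷
  All.map (λ { (lo<a , a≤) → lo<a , ≤-trans a≤ (+-monoʳ-≤ lo (n≤1+n k)) }) (descending-bounds lo k)

colsRL-descending : ∀ n → colsRL n ≡ descending 0 (n ∸ 1)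
colsRL-descending n = go (n ∸ 1)
  where
  go : ∀ k → map suc (downFrom k) ≡ descending 0 k
  go zero    = refl
  go (suc k) = cong (suc k ∷_) (go k)

rowsBT-descending : ∀ n c → c ≤ n → rowsBT n c ≡ descending c (n ∸ c)
rowsBT-descending n c c≤n = trans (map-upTo (n ∸_) (n ∸ c)) (go (n ∸_) (n ∸ c) entries)
  where
  go : ∀ (f : ℕ → ℕ) k → (∀ x → x ≤ k → f x ≡ c + (k ∸ x)) → applyUpTo f k ≡ descending c k
  go f zero    _       = refl
  go f (suc k) entries = cong₂ _∷_ (entries 0 z≤n) (go (f ∘′ suc) k (λ x x≤k → entries (suc x) (s≤s x≤k)))
  entries : ∀ x → x ≤ n ∸ c → n ∸ x ≡ c + (n ∸ c ∸ x)
  entries x x≤ = trans (cong (_∸ x) (sym (m+[n∸m]≡n c≤n))) (+-∸-assoc c x≤)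

concatMap-descending-snoc : ∀ (F G : ℕ → List ℕ) x lo k s → lo < s → s ≤ lo + k →
  (∀ a → s < a → F a ≡ G a) → F s ≡ G s ++ x ∷ [] → (∀ a → lo < a → a < s → F a ≡ [] × G a ≡ []) →
  concatMap F (descending lo k) ≡ concatMap G (descending lo k) ++ x ∷ []
concatMap-descending-snoc F G x lo zero s lo<s s≤lo _ _ _ =
  ⊥-elim (<⇒≱ lo<s (≤-trans s≤lo (≤-reflexive (+-identityʳ lo))))
concatMap-descending-snoc F G x lo (suc k) s lo<s s≤top above at below with m≤n⇒m<n∨m≡n s≤top
... | inj₁ s<top =
  trans (cong₂ _++_ (above (lo + suc k) s<top) (concatMap-descending-snoc F G x lo k s lo<s s≤lo+k above at below))
        (sym (++-assoc (G (lo + suc k)) (concatMap G (descending lo k)) (x ∷ [])))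
  where
  s≤lo+k : s ≤ lo + k
  s≤lo+k = ≤-pred (subst (s <_) (+-suc lo k) s<top)
... | inj₂ refl = begin
  F s ++ concatMap F (descending lo k)
    ≡⟨ cong₂ _++_ at (concatMap-none F _ (All.map proj₁ vanish)) ⟩
  (G s ++ x ∷ []) ++ []
    ≡⟨ ++-identityʳ _ ⟩
  G s ++ x ∷ []
    ≡⟨ cong (λ l → G s ++ l ++ x ∷ []) (concatMap-none G _ (All.map proj₂ vanish)) ⟨
  G s ++ concatMap G (descending lo k) ++ x ∷ []
    ≡⟨ ++-assoc (G s) _ (x ∷ []) ⟨
  (G s ++ concatMap G (descending lo k)) ++ x ∷ [] ∎
  where
  open ≡-Reasoning
  vanish : All (λ a → F a ≡ [] × G a ≡ []) (descending lo k)
  vanish = All.map (λ { (lo<a , a≤) → below _ lo<a (≤-trans (s≤s a≤) (≤-reflexive (sym (+-suc lo k)))) })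
                   (descending-bounds lo k)

coColumn : ℕ → List Cell → ℕ → List ℕ
coColumn n C c = select (λ a → memb (a , c) C) (λ a → n ∸ a + c) (rowsBT n c)

coColumn-empty : ∀ n C c → c ≤ n → (∀ a → c < a → a ≤ n → memb (a , c) C ≡ false) → coColumn n C c ≡ []
coColumn-empty n C c c≤n absent = select-none _ _ (rowsBT n c) (subst (All _) (sym (rowsBT-descending n c c≤n))
  (All.map (λ { (c<a , a≤) → absent _ c<a (≤-trans a≤ (≤-reflexive (m+[n∸m]≡n c≤n))) }) (descending-bounds c (n ∸ c))))

-- (s, j) is the topmost cell of X in column j, and Y is X without it.
coColumn-last : ∀ n X Y s j → j < s → s ≤ n → memb (s , j) X ≡ true → memb (s , j) Y ≡ false →
  (∀ a → s < a → memb (a , j) X ≡ memb (a , j) Y) →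
  (∀ a → j < a → a < s → memb (a , j) X ≡ false × memb (a , j) Y ≡ false) →
  coColumn n X j ≡ coColumn n Y j ++ (n ∸ s + j) ∷ []
coColumn-last n X Y s j j<s s≤n s∈X s∉Y above below rewrite rowsBT-descending n j (≤-trans (<⇒≤ j<s) s≤n) =
  concatMap-descending-snoc _ _ (n ∸ s + j) j (n ∸ j) s j<s (≤-trans s≤n (≤-reflexive (sym (m+[n∸m]≡n j≤n))))
    (λ a s<a → cong (λ β → letter β a) (above a s<a))
    at-s
    (λ a j<a a<s → let a∉X , a∉Y = below a j<a a<s in cong (λ β → letter β a) a∉X , cong (λ β → letter β a) a∉Y)
  where
  j≤n : j ≤ n
  j≤n = ≤-trans (<⇒≤ j<s) s≤n
  letter : Bool → ℕ → List ℕ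
  letter β a = if β then (n ∸ a + j) ∷ [] else []
  at-s : letter (memb (s , j) X) s ≡ letter (memb (s , j) Y) s ++ (n ∸ s + j) ∷ []
  at-s rewrite s∈X | s∉Y = refl

-- (s, j) is the cell of X read last, and Y is X without it.
wordCo-last : ∀ n X Y s j → 1 ≤ j → j < s → s ≤ n → memb (s , j) X ≡ true → memb (s , j) Y ≡ false →
  (∀ a c → ¬ (a ≡ s × c ≡ j) → memb (a , c) X ≡ memb (a , c) Y) →
  (∀ a → j < a → a < s → memb (a , j) X ≡ false) →
  (∀ a c → 1 ≤ c → c < j → c < a → a ≤ n → memb (a , c) X ≡ false) →
  wordCo n X ≡ wordCo n Y ++ (n ∸ s + j) ∷ []
wordCo-last n X Y s j 1≤j j<s s≤n s∈X s∉Y agree rows-after columns-after = begin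
  concatMap (coColumn n X) (colsRL n)
    ≡⟨ cong (concatMap (coColumn n X)) (colsRL-descending n) ⟩
  concatMap (coColumn n X) (descending 0 (n ∸ 1))
    ≡⟨ concatMap-descending-snoc (coColumn n X) (coColumn n Y) (n ∸ s + j) 0 (n ∸ 1) j 1≤j j≤n∸1 later column-j earlier ⟩
  concatMap (coColumn n Y) (descending 0 (n ∸ 1)) ++ (n ∸ s + j) ∷ []
    ≡⟨ cong (λ l → concatMap (coColumn n Y) l ++ (n ∸ s + j) ∷ []) (colsRL-descending n) ⟨
  concatMap (coColumn n Y) (colsRL n) ++ (n ∸ s + j) ∷ [] ∎
  where
  open ≡-Reasoning
  j≤n∸1 : j ≤ n ∸ 1
  j≤n∸1 = m+n≤o⇒m≤o∸n j (subst (_≤ n) (+-comm 1 j) (≤-trans j<s s≤n))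
  agree-off : ∀ a c → c ≢ j → memb (a , c) X ≡ memb (a , c) Y
  agree-off a c c≢j = agree a c (c≢j ∘′ proj₂)
  agree-on : ∀ a → a ≢ s → memb (a , j) X ≡ memb (a , j) Y
  agree-on a a≢s = agree a j (a≢s ∘′ proj₁)
  later : ∀ c → j < c → coColumn n X c ≡ coColumn n Y c
  later c j<c = select-cong _ (rowsBT n c) (λ a → agree-off a c (>⇒≢ j<c))
  column-j : coColumn n X j ≡ coColumn n Y j ++ (n ∸ s + j) ∷ []
  column-j = coColumn-last n X Y s j j<s s≤n s∈X s∉Y
    (λ a s<a → agree-on a (>⇒≢ s<a))
    (λ a j<a a<s → rows-after a j<a a<s , trans (sym (agree-on a (<⇒≢ a<s))) (rows-after a j<a a<s))
  earlier : ∀ c → 0 < c → c < j → coColumn n X c ≡ [] × coColumn n Y c ≡ []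
  earlier c 0<c c<j =
    coColumn-empty n X c c≤n (λ a → columns-after a c 0<c c<j) ,
    coColumn-empty n Y c c≤n (λ a c<a a≤n → trans (sym (agree-off a c (<⇒≢ c<j))) (columns-after a c 0<c c<j c<a a≤n))
    where
    c≤n : c ≤ n
    c≤n = ≤-trans (<⇒≤ c<j) (≤-trans (<⇒≤ j<s) s≤n)

-- The dominant part of the Rothe diagram

<⇒≤∸1 : ∀ {x y} → x < y → x ≤ y ∸ 1
<⇒≤∸1 (s≤s x≤y) = x≤y

at-∈ : ∀ v k → 1 ≤ k → k ≤ length v → at v k ∈ v
at-∈ (x ∷ v) (suc zero)    _ _         = here refl
at-∈ (x ∷ v) (suc (suc k)) _ (s≤s k<v) = there (at-∈ v (suc k) (s≤s z≤n) k<v)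

posOf-at : ∀ v y → y ∈ v → 1 ≤ posOf v y × at v (posOf v y) ≡ y
posOf-at (x ∷ v) y y∈ with x ≡ᵇ y in x≡y
... | true = s≤s z≤n , ≡ᵇ⇒≡ x y (Equivalence.from T-≡ x≡y)
posOf-at (x ∷ v) y (here refl)   | false = case trans (sym (≡ᵇ-refl x)) x≡y of λ ()
posOf-at (x ∷ v) y (there y∈v) | false with posOf v y | posOf-at v y y∈v
... | suc p | _ , at≡y = s≤s z≤n , at≡y

∈-idPerm⁻ : ∀ n x → x ∈ idPerm n → 1 ≤ x
∈-idPerm⁻ n x x∈ with ∈-map⁻ suc x∈
... | _ , _ , refl = s≤s z≤n

∈-idPerm⁺ : ∀ n x → 1 ≤ x → x ≤ n → x ∈ idPerm n
∈-idPerm⁺ n (suc x) _ x<n = ∈-map⁺ suc (∈-upTo⁺ x<n)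

InDom-mono : ∀ w {a b a′ b′} → InDom w a b → 1 ≤ a′ → a′ ≤ a → 1 ≤ b′ → b′ ≤ b → InDom w a′ b′
InDom-mono w (_ , _ , rect) 1≤a′ a′≤a 1≤b′ b′≤b =
  1≤a′ , 1≤b′ , λ k l 1≤k k≤a′ 1≤l l≤b′ → rect k l 1≤k (≤-trans k≤a′ a′≤a) 1≤l (≤-trans l≤b′ b′≤b)

Addable-unique : ∀ w {i i′ j} → Addable w i j → Addable w i′ j → i ≡ i′
Addable-unique w {i} {i′} (1≤i , 1≤j , i∉ , up , _) (1≤i′ , _ , i′∉ , up′ , _) with <-cmp i i′
... | tri< i<i′ _ _ = ⊥-elim (i∉ (InDom-mono w (up′ (≤-<-trans 1≤i i<i′)) 1≤i (<⇒≤∸1 i<i′) 1≤j ≤-refl))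
... | tri≈ _ i≡i′ _ = i≡i′
... | tri> _ _ i′<i = ⊥-elim (i′∉ (InDom-mono w (up (≤-<-trans 1≤i′ i′<i)) 1≤i′ (<⇒≤∸1 i′<i) 1≤j ≤-refl))

Addable-α-fits : ∀ {n w i j} → Addable w i j → IsAlpha n w j → i + j ≤ n
Addable-α-fits {n} {w} {j = j} add ((i₀ , add₀ , fits₀) , _) =
  subst (λ k → k + j ≤ n) (sym (Addable-unique w add add₀)) fits₀

module _ {n : ℕ} {w : List ℕ} {j : ℕ} (α : IsAlpha n w j) where
  -- A cell left of column α(w) outside dom(w) would, by induction, be addable; InDom is not
  -- decided here, so this is stated double-negated.
  dom-left-of-α : ∀ r c → suc c < j → suc r + suc c ≤ n → ¬ ¬ InDom w (suc r) (suc c)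
  neighbour-above : ∀ r c → suc c < j → suc r + suc c ≤ n → ¬ ¬ (1 < suc r → InDom w r (suc c))
  neighbour-left : ∀ r c → suc c < j → suc r + suc c ≤ n → ¬ ¬ (1 < suc c → InDom w (suc r) c)

  dom-left-of-α r c c<j fits ∉dom =
    neighbour-above r c c<j fits λ up → neighbour-left r c c<j fits λ left →
      proj₂ α (suc c) c<j (suc r , (s≤s z≤n , s≤s z≤n , ∉dom , up , left) , fits)

  neighbour-above zero    c _   _    = λ k → k (λ { (s≤s ()) })
  neighbour-above (suc r) c c<j fits = ¬¬-map (λ d _ → d) (dom-left-of-α r c c<j (≤-trans (n≤1+n _) fits))

  neighbour-left r zero    _   _    = λ k → k (λ { (s≤s ()) })
  neighbour-left r (suc c) c<j fits =
    ¬¬-map (λ d _ → d) (dom-left-of-α r c (<-trans (n<1+n _) c<j) (≤-trans (+-monoʳ-≤ (suc r) (n≤1+n _)) fits))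

Addable-InDom : ∀ {n w i j} → IsPerm n w → Addable w i j → i + j ≤ n →
                (∀ k → 1 ≤ k → k ≤ i → at w k ≢ j) → InDom w i j
Addable-InDom {n} {w} {i} {suc j′} perm (1≤i , 1≤j , _ , up , left) fits j∉ = 1≤i , 1≤j , rectangle
  where
  i≤w : i ≤ length w
  i≤w = ≤-trans (m≤m+n i _) (≤-trans fits (≤-reflexive (sym (trans (↭-length perm) (length-idPerm n)))))
  j≤wi : suc j′ ≤ at w i
  j≤wi with 1 <? suc j′
  ... | yes 1<j = proj₁ (proj₂ (proj₂ (left 1<j)) i j′ 1≤i ≤-refl (<⇒≤∸1 1<j) ≤-refl)
  ... | no 1≮j  = ≤-trans (≮⇒≥ 1≮j) (∈-idPerm⁻ n _ (∈-resp-↭ perm (at-∈ w i 1≤i i≤w)))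
  i<pos : i < posOf w (suc j′)
  i<pos with posOf-at w (suc j′) (∈-resp-↭ (↭-sym perm) (∈-idPerm⁺ n (suc j′) 1≤j (≤-trans (m≤n+m _ i) fits)))
  ... | 1≤p , at≡j = ≰⇒> (λ p≤i → j∉ _ 1≤p p≤i at≡j)
  rectangle : ∀ k l → 1 ≤ k → k ≤ i → 1 ≤ l → l ≤ suc j′ → InRothe w k l
  rectangle k l 1≤k k≤i 1≤l l≤j with m≤n⇒m<n∨m≡n k≤i | m≤n⇒m<n∨m≡n l≤j
  ... | inj₁ k<i | _         = proj₂ (proj₂ (up (≤-<-trans 1≤k k<i))) k l 1≤k (<⇒≤∸1 k<i) 1≤l l≤j
  ... | inj₂ refl | inj₁ l<j = proj₂ (proj₂ (left (≤-<-trans 1≤l l<j))) k l 1≤k ≤-refl 1≤l (<⇒≤∸1 l<j)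
  ... | inj₂ refl | inj₂ refl = ≤∧≢⇒< j≤wi (j∉ k 1≤k ≤-refl ∘′ sym) , i<pos

module Dominance (n : ℕ) (w : List ℕ) (P : List Cell) (perm : IsPerm n w) (δP≡w : δP n P ≡ w) where
  open Columns n P using (small-value-in-prefix; value-absent-from-prefix)

  length-w : length w ≡ n
  length-w = trans (↭-length perm) (length-idPerm n)

  InDom⊆P : ∀ {a b} → InDom w a b → a + b ≤ n → memb (a , b) P ≡ true
  InDom⊆P {a} {zero}   (_ , () , _)        _
  InDom⊆P {a} {suc b′} (1≤a , _ , rect) fits with memb (a , suc b′) P in a∉P
  ... | true  = refl
  ... | false = ⊥-elim (<⇒≢ some (sym none))
    where
    p : ℕ → Bool
    p = isAtMost (suc b′)
    some : 1 ≤ countPrefix p a w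
    some = subst (λ v → 1 ≤ countPrefix p a v) δP≡w (small-value-in-prefix a b′ 1≤a fits a∉P)
    none : countPrefix p a w ≡ 0
    none = countPrefix-none p a w (λ k 1≤k k≤a →
      dec-false (at w k ≤? suc b′) (<⇒≱ (proj₁ (rect k (suc b′) 1≤k k≤a (s≤s z≤n) ≤-refl))))

  left-of-α⊆P : ∀ {j} → IsAlpha n w j → ∀ r c → 1 ≤ r → 1 ≤ c → c < j → r + c ≤ n → memb (r , c) P ≡ true
  left-of-α⊆P α (suc r) (suc c) _ _ c<j fits = decidable-stable (memb (suc r , suc c) P Bool.≟ true)
    (¬¬-map (λ d → InDom⊆P d fits) (dom-left-of-α {w = w} α r c c<j fits))

  above-addable⊆P : ∀ {i j} → Addable w i j → i + j ≤ n → ∀ r → 1 ≤ r → r < i → memb (r , j) P ≡ true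
  above-addable⊆P (_ , 1≤j , _ , up , _) fits r 1≤r r<i =
    InDom⊆P (InDom-mono w (up (≤-<-trans 1≤r r<i)) 1≤r (<⇒≤∸1 r<i) 1≤j ≤-refl) (≤-trans (+-monoˡ-≤ _ (<⇒≤ r<i)) fits)

  -- Otherwise the whole top of column j would lie in P, keeping j out of the first i entries of w,
  -- which would put (i, j) into dom(w).
  addable∉P : ∀ {i j} → Addable w i j → i + j ≤ n → memb (i , j) P ≡ false
  addable∉P {i} {zero}   (_ , () , _) _
  addable∉P {i} {suc j′} add@(1≤i , _ , ∉dom , _) fits with memb (i , suc j′) P in ij∈P
  ... | false = refl
  ... | true  = ⊥-elim (∉dom (Addable-InDom perm add fits j∉))
    where
    p : ℕ → Bool
    p = isValue (suc j′)
    top : ∀ r → 1 ≤ r → r ≤ i → memb (r , suc j′) P ≡ true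
    top r 1≤r r≤i with m≤n⇒m<n∨m≡n r≤i
    ... | inj₁ r<i  = above-addable⊆P add fits r 1≤r r<i
    ... | inj₂ refl = ij∈P
    absent : countPrefix p i w ≡ 0
    absent = subst (λ v → countPrefix p i v ≡ 0) δP≡w (value-absent-from-prefix i j′ 1≤i fits top)
    j∉ : ∀ k → 1 ≤ k → k ≤ i → at w k ≢ suc j′
    j∉ k 1≤k k≤i wk≡j = <⇒≢ (countPrefix-positive p i w k 1≤k k≤i k≤w (dec-true (at w k ≟ suc j′) wk≡j)) (sym absent)
      where
      k≤w : k ≤ length w
      k≤w = ≤-trans k≤i (≤-trans (m≤m+n i _) (≤-trans fits (≤-reflexive (sym length-w))))

  wordCo-addable : ∀ {i j} → IsAlpha n w j → Addable w i j →
                   wordCo n (coP n P) ≡ wordCo n (coP n ((i , j) ∷ P)) ++ (n ∸ (i + j) + j) ∷ []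
  wordCo-addable {i} {j} α add@(1≤i , 1≤j , _) =
    wordCo-last n (coP n P) (coP n Q) (i + j) j 1≤j (m<n+m j 1≤i) fits
      (coP-complement n P i j (∈-cellsT n i j 1≤i 1≤j fits) (addable∉P add fits))
      (coP-outside n Q (i + j) j ij∈Q)
      (λ a c ac≢ → sym (coP-insert n P i j a c ac≢))
      (λ a j<a a<s → coP-outside n P a j (above-addable⊆P add fits (a ∸ j) (m<n⇒0<n∸m j<a)
        (≤-trans (∸-monoˡ-< a<s (<⇒≤ j<a)) (≤-reflexive (m+n∸n≡m i j)))))
      (λ a c 1≤c c<j c<a a≤n → coP-outside n P a c (left-of-α⊆P α (a ∸ c) c (m<n⇒0<n∸m c<a) 1≤c c<j
        (≤-trans (≤-reflexive (m∸n+n≡m (<⇒≤ c<a))) a≤n)))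
    where
    Q : List Cell
    Q = (i , j) ∷ P
    fits : i + j ≤ n
    fits = Addable-α-fits {w = w} add α
    ij∈Q : memb (i + j ∸ j , j) Q ≡ true
    ij∈Q = subst (λ r → memb (r , j) Q ≡ true) (sym (m+n∸n≡m i j)) (cong (_∨ memb (i , j) P) (isCell-refl (i , j)))

lemma6p3 : (n : ℕ) → 1 ≤ n → (w : List ℕ) → IsPerm n w → w ≢ w0 n →
           (i j : ℕ) → Addable w i j → IsAlpha n w j →
           (P : List Cell) → InPipes n w P →
           box (δco n ((i , j) ∷ P)) i ≡ δco n P
lemma6p3 n _ w perm _ i j add α P (_ , δP≡w) = begin
  box (reverse (δ n U)) i       ≡⟨ box-reverse-at (δ n U) x i 1≤x (proj₁ add) x+i≡ ⟩
  reverse (demStep (δ n U) x)   ≡⟨ cong reverse (foldl-++ demStep (idPerm n) U (x ∷ [])) ⟨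
  reverse (δ n (U ++ x ∷ []))   ≡⟨ cong (reverse ∘′ δ n) (Dominance.wordCo-addable n w P perm δP≡w α add) ⟨
  δco n P                       ∎
  where
  open ≡-Reasoning
  U : List ℕ
  U = wordCo n (coP n ((i , j) ∷ P))
  x : ℕ
  x = n ∸ (i + j) + j
  1≤x : 1 ≤ x
  1≤x = ≤-trans (proj₁ (proj₂ add)) (m≤n+m j _)
  x+i≡ : x + i ≡ length (δ n U)
  x+i≡ = begin
    n ∸ (i + j) + j + i   ≡⟨ +-assoc (n ∸ (i + j)) j i ⟩
    n ∸ (i + j) + (j + i) ≡⟨ cong (n ∸ (i + j) +_) (+-comm j i) ⟩
    n ∸ (i + j) + (i + j) ≡⟨ m∸n+n≡m (Addable-α-fits {w = w} add α) ⟩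
    n                     ≡⟨ trans (↭-length (foldl-demStep-↭ U (idPerm n))) (length-idPerm n) ⟨
    length (δ n U)        ∎
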